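{- For a positive integer $n$ let $d_2(n)$ denote the largest odd divisor of $n$. For an integer $m\ge0$ put $$P_m=\prod_{j=0}^{m}\frac{4(3j+1)(3j+2)}{d_2(3j+1)\,d_2(3j+2)}.$$ Then $P_m\le(3m+2)\,2^{4m+4}$. -}

module Defs where

open import Data.Nat using (ℕ; zero; suc; _+_; _*_; _^_; _≡ᵇ_; NonZero)
open import Data.Nat.Base using (_/_; _%_)
open import Data.Bool using (Bool; true; false; if_then_else_)
open import Data.Rational using (ℚ; 1ℚ; _÷_; _≤_) renaming (_*_ to _*ℚ_)
import Data.Rational as ℚ
open import Data.Integer using (+_)

-- Defined on positive integers, given as n = suc k; the fuel argument
-- (k+1 halvings) is always sufficient.  The result is returned as suc r
-- so that it is visibly nonzero.
oddPart-fuel : ℕ → ℕ → ℕ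
-- oddPart-fuel f k  computes (d₂(k+1)) ∸ 1
oddPart-fuel zero    k = k
oddPart-fuel (suc f) k with (suc k) % 2 ≡ᵇ 0
... | true  = oddPart-fuel f ((suc k / 2) Data.Nat.∸ 1)
... | false = k

d₂ : ℕ → ℕ
d₂ zero    = 0          -- not used (d₂ is only defined for n ≥ 1)
d₂ (suc k) = suc (oddPart-fuel (suc k) k)

toℚ : ℕ → ℚ
toℚ n = ℚ._/_ (+ n) 1

factor : ℕ → ℚ
factor j = ℚ._/_ (+ (4 * (3 * j + 1) * (3 * j + 2)))
                 (d₂ (suc (3 * j)) * d₂ (suc (3 * j + 1)))

P : ℕ → ℚ
P zero    = factor 0
P (suc m) = P m *ℚ factor (suc m)

-- Write n₂ = n / d₂(n) for the 2-part of n, so that the j-th factor is the integer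
-- f(j) = 4 · (3j+1)₂ · (3j+2)₂.  Of 6i+1, 6i+2, 6i+4, 6i+5 the odd ones have 2-part 1, while
-- 6i+2 = 2(3i+1) and 6i+4 = 2(3i+2); hence f(2i) · f(2i+1) = 16 f(i) and P(2i+1) = 16^(i+1) P(i).
-- For even m, P(m) = P(m+1) / f(m+1) with f(m+1) ≥ 8, and f(m+1) ≥ 16 when 4 ∣ m.  Strong induction
-- along m ↦ ⌊m/2⌋ then gives P(m) ≤ 8 (m+1) 16^m, which is below (3m+2) 2^(4m+4).
module Submission where

open import Defs
open import Data.Nat using (ℕ; zero; suc; _+_; _*_; _^_; _∸_; _≤_; _<_; z≤n; s≤s; _≡ᵇ_; NonZero)
open import Data.Nat.Base using (_/_; _%_)
open import Data.Nat.Properties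
open import Data.Nat.DivMod
  using ([m+kn]%n≡m%n; m*n%n≡0; m*n/n≡m; m/n<m; m*[n/m]≡n; m≥n⇒m/n>0)
open import Data.Nat.Divisibility using (_∣_; ∣-refl; ∣-trans; m∣m*n; ∣⇒≤)
open import Data.Nat.Induction using (<-rec)
open import Data.Nat.Tactic.RingSolver using (solve-∀)
open import Data.Bool using (true; false)
open import Algebra.Definitions.RawMagma using (_,_)
import Data.Integer as ℤ
import Data.Integer.Properties as ℤ
open import Data.Rational using (mkℚ)
import Data.Rational as ℚ
import Data.Rational.Properties as ℚ
open import Data.Rational.Unnormalised using (mkℚᵘ; *≡*)
open import Data.Nat.Coprimality using (1-coprimeTo)
import Data.Nat.Coprimality as Coprime
open import Relation.Binary.PropositionalEquality

data EvenOdd : ℕ → Set where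
  even : ∀ n → EvenOdd (n * 2)
  odd  : ∀ n → EvenOdd (suc (n * 2))

evenOdd : ∀ n → EvenOdd n
evenOdd zero = even 0
evenOdd (suc n) with evenOdd n
... | even k = odd k
... | odd k  = even (suc k)

oddPart-fuel-irrelevant : ∀ {f f′ k} → k < f → k < f′ → oddPart-fuel f k ≡ oddPart-fuel f′ k
oddPart-fuel-irrelevant {suc f} {suc f′} {zero} _ _ = refl
oddPart-fuel-irrelevant {suc f} {suc f′} {suc k} (s≤s k<f) (s≤s k<f′)
  with suc (suc k) % 2 ≡ᵇ 0
... | true  = oddPart-fuel-irrelevant (≤-<-trans half≤k k<f) (≤-<-trans half≤k k<f′)
  where
  half≤k : suc (suc k) / 2 ∸ 1 ≤ k
  half≤k = ∸-monoˡ-≤ 1 (≤-pred (m/n<m (suc (suc k)) 2 (s≤s (s≤s z≤n))))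
... | false = refl

d₂-odd : ∀ n → d₂ (suc (n * 2)) ≡ suc (n * 2)
d₂-odd n rewrite [m+kn]%n≡m%n 1 n 2 ⦃ _ ⦄ = refl

d₂-double : ∀ n → d₂ (n * 2) ≡ d₂ n
d₂-double zero = refl
d₂-double (suc n) rewrite m*n%n≡0 (suc n) 2 ⦃ _ ⦄ | m*n/n≡m (suc n) 2 ⦃ _ ⦄ =
  cong suc (oddPart-fuel-irrelevant (s≤s (m≤m*n n 2)) ≤-refl)

d₂∣n : ∀ n → d₂ n ∣ n
d₂∣n = <-rec (λ n → d₂ n ∣ n) step
  where
  step : ∀ n → (∀ {m} → m < n → d₂ m ∣ m) → d₂ n ∣ n
  step n ih with evenOdd n
  ... | odd k        = subst (_∣ suc (k * 2)) (sym (d₂-odd k)) ∣-refl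
  ... | even zero    = ∣-refl
  ... | even (suc k) = subst (_∣ suc k * 2) (sym (d₂-double (suc k)))
                         (∣-trans (ih (m<m*n (suc k) 2 (s≤s (s≤s z≤n)))) (m∣m*n 2))

-- Junk value 0 at n = 0, matching d₂ 0 = 0.
twoPart : ℕ → ℕ
twoPart zero    = 0
twoPart (suc n) = suc n / d₂ (suc n)

d₂*twoPart≡id : ∀ n → d₂ n * twoPart n ≡ n
d₂*twoPart≡id zero    = refl
d₂*twoPart≡id (suc n) = m*[n/m]≡n (d₂∣n (suc n))

twoPart-odd : ∀ n → twoPart (suc (n * 2)) ≡ 1
twoPart-odd n = *-cancelˡ-≡ (twoPart m) 1 m (begin
  m * twoPart m      ≡⟨ cong (_* twoPart m) (d₂-odd n) ⟨
  d₂ m * twoPart m   ≡⟨ d₂*twoPart≡id m ⟩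
  m                  ≡⟨ *-identityʳ m ⟨
  m * 1              ∎)
  where
  open ≡-Reasoning
  m = suc (n * 2)

twoPart-double : ∀ n → twoPart (n * 2) ≡ 2 * twoPart n
twoPart-double zero = refl
twoPart-double n@(suc _) = *-cancelˡ-≡ (twoPart (n * 2)) (2 * twoPart n) (d₂ (n * 2)) (begin
  d₂ (n * 2) * twoPart (n * 2)  ≡⟨ d₂*twoPart≡id (n * 2) ⟩
  n * 2                         ≡⟨ cong (_* 2) (d₂*twoPart≡id n) ⟨
  d₂ n * twoPart n * 2          ≡⟨ *-assoc (d₂ n) (twoPart n) 2 ⟩
  d₂ n * (twoPart n * 2)        ≡⟨ cong₂ _*_ (sym (d₂-double n)) (*-comm (twoPart n) 2) ⟩
  d₂ (n * 2) * (2 * twoPart n)  ∎)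
  where open ≡-Reasoning

twoPart-positive : ∀ n → 1 ≤ twoPart (suc n)
twoPart-positive n = m≥n⇒m/n>0 (∣⇒≤ (d₂∣n (suc n)))

factorℕ : ℕ → ℕ
factorℕ j = 4 * (twoPart (suc (3 * j)) * twoPart (suc (3 * j + 1)))

factorℕ-even : ∀ i → factorℕ (i * 2) ≡ 8 * twoPart (suc (3 * i))
factorℕ-even i = begin
  4 * (twoPart (suc (3 * (i * 2))) * twoPart (suc (3 * (i * 2) + 1)))
    ≡⟨ cong₂ (λ a b → 4 * (twoPart a * twoPart b)) (6i+1 i) (6i+2 i) ⟩
  4 * (twoPart (suc (3 * i * 2)) * twoPart (suc (3 * i) * 2))
    ≡⟨ cong₂ (λ a b → 4 * (a * b)) (twoPart-odd (3 * i)) (twoPart-double (suc (3 * i))) ⟩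
  4 * (1 * (2 * twoPart (suc (3 * i))))
    ≡⟨ constants (twoPart (suc (3 * i))) ⟩
  8 * twoPart (suc (3 * i)) ∎
  where
  open ≡-Reasoning
  6i+1 : ∀ i → suc (3 * (i * 2)) ≡ suc (3 * i * 2)
  6i+1 = solve-∀
  6i+2 : ∀ i → suc (3 * (i * 2) + 1) ≡ suc (3 * i) * 2
  6i+2 = solve-∀
  constants : ∀ x → 4 * (1 * (2 * x)) ≡ 8 * x
  constants = solve-∀

factorℕ-odd : ∀ i → factorℕ (suc (i * 2)) ≡ 8 * twoPart (suc (3 * i + 1))
factorℕ-odd i = begin
  4 * (twoPart (suc (3 * suc (i * 2))) * twoPart (suc (3 * suc (i * 2) + 1)))
    ≡⟨ cong₂ (λ a b → 4 * (twoPart a * twoPart b)) (6i+4 i) (6i+5 i) ⟩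
  4 * (twoPart (suc (3 * i + 1) * 2) * twoPart (suc ((3 * i + 2) * 2)))
    ≡⟨ cong₂ (λ a b → 4 * (a * b)) (twoPart-double (suc (3 * i + 1))) (twoPart-odd (3 * i + 2)) ⟩
  4 * (2 * twoPart (suc (3 * i + 1)) * 1)
    ≡⟨ constants (twoPart (suc (3 * i + 1))) ⟩
  8 * twoPart (suc (3 * i + 1)) ∎
  where
  open ≡-Reasoning
  6i+4 : ∀ i → suc (3 * suc (i * 2)) ≡ suc (3 * i + 1) * 2
  6i+4 = solve-∀
  6i+5 : ∀ i → suc (3 * suc (i * 2) + 1) ≡ suc ((3 * i + 2) * 2)
  6i+5 = solve-∀
  constants : ∀ x → 4 * (2 * x * 1) ≡ 8 * x
  constants = solve-∀

factorℕ-pair : ∀ i → factorℕ (i * 2) * factorℕ (suc (i * 2)) ≡ 16 * factorℕ i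
factorℕ-pair i rewrite factorℕ-even i | factorℕ-odd i =
  constants (twoPart (suc (3 * i))) (twoPart (suc (3 * i + 1)))
  where
  constants : ∀ x y → 8 * x * (8 * y) ≡ 16 * (4 * (x * y))
  constants = solve-∀

8≤factorℕ[2i+1] : ∀ i → 8 ≤ factorℕ (suc (i * 2))
8≤factorℕ[2i+1] i rewrite factorℕ-odd i = *-monoʳ-≤ 8 (twoPart-positive (3 * i + 1))

16≤factorℕ[4k+5] : ∀ k → 16 ≤ factorℕ (suc (suc k * 2 * 2))
16≤factorℕ[4k+5] k = begin
  16                                   ≤⟨ *-monoʳ-≤ 16 (twoPart-positive (3 * k + 3)) ⟩
  16 * twoPart (suc (3 * k + 3))       ≡⟨ *-assoc 8 2 (twoPart (suc (3 * k + 3))) ⟩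
  8 * (2 * twoPart (suc (3 * k + 3)))  ≡⟨ cong (8 *_) (twoPart-double (suc (3 * k + 3))) ⟨
  8 * twoPart (suc (3 * k + 3) * 2)    ≡⟨ cong (λ a → 8 * twoPart a) (6k+8 k) ⟨
  8 * twoPart (suc (3 * (suc k * 2) + 1)) ≡⟨ factorℕ-odd (suc k * 2) ⟨
  factorℕ (suc (suc k * 2 * 2))        ∎
  where
  open ≤-Reasoning
  6k+8 : ∀ k → suc (3 * (suc k * 2) + 1) ≡ suc (3 * k + 3) * 2
  6k+8 = solve-∀

Pℕ : ℕ → ℕ
Pℕ zero    = factorℕ 0
Pℕ (suc m) = Pℕ m * factorℕ (suc m)

Pℕ-odd : ∀ i → Pℕ (suc (i * 2)) ≡ 16 ^ suc i * Pℕ i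
Pℕ-odd zero    = refl
Pℕ-odd (suc i) = begin
  Pℕ (suc (i * 2)) * factorℕ (suc i * 2) * factorℕ (suc (suc i * 2))
    ≡⟨ *-assoc (Pℕ (suc (i * 2))) _ _ ⟩
  Pℕ (suc (i * 2)) * (factorℕ (suc i * 2) * factorℕ (suc (suc i * 2)))
    ≡⟨ cong₂ _*_ (Pℕ-odd i) (factorℕ-pair (suc i)) ⟩
  16 ^ suc i * Pℕ i * (16 * factorℕ (suc i))
    ≡⟨ regroup (16 ^ suc i) (Pℕ i) (factorℕ (suc i)) ⟩
  16 * 16 ^ suc i * (Pℕ i * factorℕ (suc i)) ∎
  where
  open ≡-Reasoning
  regroup : ∀ x p f → x * p * (16 * f) ≡ 16 * x * (p * f)
  regroup = solve-∀

bound : ℕ → ℕ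
bound m = 8 * suc m * 16 ^ m

^[n*2]≡^n*^n : ∀ b n → b ^ (n * 2) ≡ b ^ n * b ^ n
^[n*2]≡^n*^n b n = trans (cong (b ^_) (trans (*-comm n 2) (cong (n +_) (+-identityʳ n))))
                         (^-distribˡ-+-* b n n)

bound-odd : ∀ i → 16 ^ suc i * bound i ≤ bound (suc (i * 2))
bound-odd i = begin
  16 * X * (8 * suc i * X)               ≤⟨ ≤″⇒≤ (_ , poly i X) ⟩
  8 * suc (suc (i * 2)) * (16 * (X * X)) ≡⟨ cong (λ Z → 8 * suc (suc (i * 2)) * (16 * Z)) (^[n*2]≡^n*^n 16 i) ⟨
  bound (suc (i * 2))                    ∎
  where
  open ≤-Reasoning
  X = 16 ^ i
  poly : ∀ i X → 16 * X * (8 * suc i * X) + 128 * suc i * (X * X)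
                 ≡ 8 * suc (suc (i * 2)) * (16 * (X * X))
  poly = solve-∀

bound-4k+2 : ∀ k → 16 ^ suc (suc (k * 2)) * (16 ^ suc k * bound k) ≤ bound (suc (k * 2) * 2) * 8
bound-4k+2 k = begin
  16 * (16 * 16 ^ (k * 2)) * (16 * X * (8 * suc k * X))
    ≡⟨ cong (λ Z → 16 * (16 * Z) * (16 * X * (8 * suc k * X))) (^[n*2]≡^n*^n 16 k) ⟩
  16 * (16 * (X * X)) * (16 * X * (8 * suc k * X))
    ≤⟨ ≤″⇒≤ (_ , poly k X) ⟩
  8 * suc (suc (k * 2) * 2) * (16 * (16 * (X * X * (X * X)))) * 8
    ≡⟨ cong (λ Z → 8 * suc (suc (k * 2) * 2) * (16 * (16 * Z)) * 8) 16^[k*2*2] ⟨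
  bound (suc (k * 2) * 2) * 8
    ∎
  where
  open ≤-Reasoning
  X = 16 ^ k
  16^[k*2*2] : 16 ^ (k * 2 * 2) ≡ X * X * (X * X)
  16^[k*2*2] = trans (^[n*2]≡^n*^n 16 (k * 2)) (cong₂ _*_ (^[n*2]≡^n*^n 16 k) (^[n*2]≡^n*^n 16 k))
  poly : ∀ k X → 16 * (16 * (X * X)) * (16 * X * (8 * suc k * X))
                 + 16384 * (1 + k * 2) * (X * X * (X * X))
                 ≡ 8 * suc (suc (k * 2) * 2) * (16 * (16 * (X * X * (X * X)))) * 8
  poly = solve-∀

bound-4k+4 : ∀ k → 16 ^ suc (suc k * 2) * bound (suc k * 2) ≤ bound (suc k * 2 * 2) * 16
bound-4k+4 k = begin
  16 * (16 * (16 * (16 ^ (k * 2)))) * (8 * suc (suc k * 2) * (16 * (16 * (16 ^ (k * 2)))))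
    ≤⟨ ≤″⇒≤ (_ , poly 16 k (16 ^ (k * 2))) ⟩
  8 * suc (suc k * 2 * 2) * (16 * (16 * (16 * (16 * ((16 ^ (k * 2)) * (16 ^ (k * 2))))))) * 16
    ≡⟨ cong (λ Z → 8 * suc (suc k * 2 * 2) * (16 * (16 * (16 * (16 * Z)))) * 16) (^[n*2]≡^n*^n 16 (k * 2)) ⟨
  bound (suc k * 2 * 2) * 16
    ∎
  where
  open ≤-Reasoning
  -- Stated for an arbitrary base c: with the literal 16 the solver is impractically slow.
  poly : ∀ c k Y → c * (c * (c * Y)) * (8 * suc (suc k * 2) * (c * (c * Y)))
                   + 8 * (2 * suc k) * (c * c * c * c * c) * (Y * Y)
                   ≡ 8 * suc (suc k * 2 * 2) * (c * (c * (c * (c * (Y * Y))))) * c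
  poly = solve-∀

bound≤ : ∀ m → bound m ≤ (3 * m + 2) * 2 ^ (4 * m + 4)
bound≤ m = begin
  8 * suc m * X                ≤⟨ ≤″⇒≤ (_ , poly m X) ⟩
  (3 * m + 2) * (16 * X)       ≡⟨ cong ((3 * m + 2) *_) 2^[4m+4] ⟨
  (3 * m + 2) * 2 ^ (4 * m + 4) ∎
  where
  open ≤-Reasoning
  X = 16 ^ m
  2^[4m+4] : 2 ^ (4 * m + 4) ≡ 16 * X
  2^[4m+4] = trans (cong (2 ^_) (trans (+-comm (4 * m) 4) (sym (*-suc 4 m))))
                   (sym (^-*-assoc 2 4 (suc m)))
  poly : ∀ m X → 8 * suc m * X + (40 * m + 24) * X ≡ (3 * m + 2) * (16 * X)
  poly = solve-∀

data Mod4View : ℕ → Set where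
  zero : Mod4View 0
  odd  : ∀ i → Mod4View (suc (i * 2))
  4k+2 : ∀ k → Mod4View (suc (k * 2) * 2)
  4k+4 : ∀ k → Mod4View (suc k * 2 * 2)

mod4View : ∀ m → Mod4View m
mod4View m with evenOdd m
... | odd i  = odd i
... | even i with evenOdd i
...   | odd k        = 4k+2 k
...   | even zero    = zero
...   | even (suc k) = 4k+4 k

Pℕ≤bound : ∀ m → Pℕ m ≤ bound m
Pℕ≤bound = <-rec (λ m → Pℕ m ≤ bound m) step
  where
  open ≤-Reasoning
  step : ∀ m → (∀ {n} → n < m → Pℕ n ≤ bound n) → Pℕ m ≤ bound m
  step m ih with mod4View m
  ... | zero   = ≤-refl
  ... | odd i  = begin
    Pℕ (suc (i * 2))      ≡⟨ Pℕ-odd i ⟩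
    16 ^ suc i * Pℕ i     ≤⟨ *-monoʳ-≤ (16 ^ suc i) (ih (s≤s (m≤m*n i 2))) ⟩
    16 ^ suc i * bound i  ≤⟨ bound-odd i ⟩
    bound (suc (i * 2))   ∎
  ... | 4k+2 k = *-cancelʳ-≤ (Pℕ m′) (bound m′) 8 (begin
    Pℕ m′ * 8                                   ≤⟨ *-monoʳ-≤ (Pℕ m′) (8≤factorℕ[2i+1] (suc (k * 2))) ⟩
    Pℕ (suc m′)                                 ≡⟨ Pℕ-odd (suc (k * 2)) ⟩
    16 ^ suc (suc (k * 2)) * Pℕ (suc (k * 2))   ≡⟨ cong (16 ^ suc (suc (k * 2)) *_) (Pℕ-odd k) ⟩
    16 ^ suc (suc (k * 2)) * (16 ^ suc k * Pℕ k)
      ≤⟨ *-monoʳ-≤ (16 ^ suc (suc (k * 2))) (*-monoʳ-≤ (16 ^ suc k) (ih k<m′)) ⟩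
    16 ^ suc (suc (k * 2)) * (16 ^ suc k * bound k) ≤⟨ bound-4k+2 k ⟩
    bound m′ * 8                                ∎)
    where
    m′ = suc (k * 2) * 2
    k<m′ : k < m′
    k<m′ = <-≤-trans (s≤s (m≤m*n k 2)) (m≤m*n (suc (k * 2)) 2)
  ... | 4k+4 k = *-cancelʳ-≤ (Pℕ m′) (bound m′) 16 (begin
    Pℕ m′ * 16                                  ≤⟨ *-monoʳ-≤ (Pℕ m′) (16≤factorℕ[4k+5] k) ⟩
    Pℕ (suc m′)                                 ≡⟨ Pℕ-odd (suc k * 2) ⟩
    16 ^ suc (suc k * 2) * Pℕ (suc k * 2)
      ≤⟨ *-monoʳ-≤ (16 ^ suc (suc k * 2)) (ih (m<m*n (suc k * 2) 2 (s≤s (s≤s z≤n)))) ⟩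
    16 ^ suc (suc k * 2) * bound (suc k * 2)    ≤⟨ bound-4k+4 k ⟩
    bound m′ * 16                               ∎)
    where
    m′ = suc k * 2 * 2

toℚ≡mkℚ : ∀ a → toℚ a ≡ mkℚ (ℤ.+ a) 0 (Coprime.sym (1-coprimeTo a))
toℚ≡mkℚ a = ℚ.normalize-coprime (Coprime.sym (1-coprimeTo a))

toℚ-* : ∀ a b → toℚ (a * b) ≡ toℚ a ℚ.* toℚ b
toℚ-* a b = sym (trans (cong₂ ℚ._*_ (toℚ≡mkℚ a) (toℚ≡mkℚ b)) (cong (ℚ._/ 1) (sym (ℤ.pos-* a b))))

toℚ-mono-≤ : ∀ {a b} → a ≤ b → toℚ a ℚ.≤ toℚ b
toℚ-mono-≤ {a} {b} a≤b = subst₂ ℚ._≤_ (sym (toℚ≡mkℚ a)) (sym (toℚ≡mkℚ b))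
  (ℚ.*≤* (subst₂ ℤ._≤_ (sym (ℤ.*-identityʳ _)) (sym (ℤ.*-identityʳ _)) (ℤ.+≤+ a≤b)))

/≡toℚ : ∀ n d q .⦃ _ : NonZero d ⦄ → n ≡ q * d → ℤ.+ n ℚ./ d ≡ toℚ q
/≡toℚ n (suc d) q n≡q*d =
  ℚ.fromℚᵘ-cong {mkℚᵘ (ℤ.+ n) d} {mkℚᵘ (ℤ.+ q) 0}
    (*≡* (trans (ℤ.*-identityʳ (ℤ.+ n)) (trans (cong ℤ.+_ n≡q*d) (ℤ.pos-* q (suc d)))))

factor≡toℚ-factorℕ : ∀ j → factor j ≡ toℚ (factorℕ j)
factor≡toℚ-factorℕ j = /≡toℚ _ (dA * dB) (factorℕ j) (begin
  4 * (3 * j + 1) * (3 * j + 2)     ≡⟨ shift j ⟩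
  4 * suc (3 * j) * suc (3 * j + 1)
    ≡⟨ cong₂ (λ a b → 4 * a * b) (d₂*twoPart≡id (suc (3 * j))) (d₂*twoPart≡id (suc (3 * j + 1))) ⟨
  4 * (dA * tA) * (dB * tB)         ≡⟨ regroup dA dB tA tB ⟩
  4 * (tA * tB) * (dA * dB)         ∎)
  where
  open ≡-Reasoning
  dA = d₂ (suc (3 * j))
  dB = d₂ (suc (3 * j + 1))
  tA = twoPart (suc (3 * j))
  tB = twoPart (suc (3 * j + 1))
  shift : ∀ j → 4 * (3 * j + 1) * (3 * j + 2) ≡ 4 * suc (3 * j) * suc (3 * j + 1)
  shift = solve-∀
  regroup : ∀ dA dB tA tB → 4 * (dA * tA) * (dB * tB) ≡ 4 * (tA * tB) * (dA * dB)
  regroup = solve-∀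

P≡toℚ-Pℕ : ∀ m → P m ≡ toℚ (Pℕ m)
P≡toℚ-Pℕ zero    = factor≡toℚ-factorℕ 0
P≡toℚ-Pℕ (suc m) =
  trans (cong₂ ℚ._*_ (P≡toℚ-Pℕ m) (factor≡toℚ-factorℕ (suc m))) (sym (toℚ-* (Pℕ m) _))

lemma12 : (m : ℕ) → P m ℚ.≤ toℚ ((3 * m + 2) * 2 ^ (4 * m + 4))
lemma12 m rewrite P≡toℚ-Pℕ m = toℚ-mono-≤ (≤-trans (Pℕ≤bound m) (bound≤ m))
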